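{- For every $n\geq 1$ there exists an irreducible, triangle-free, $3$-colorable graph $G_n=(V_n,E_n)$ with $\Theta(n)$ vertices such that $\mathrm{diam}(G_n)=2$, the minimum degree of $G_n$ is $\delta(G_n)=\Theta(\sqrt{n})$, and the minimum size of a dominating set of $G_n$ is $\Theta(\sqrt{n})$.
   Context: Graphs are finite, simple and undirected. For a vertex $u$, $N(u)$ is its set of neighbors. A dominating set of $G$ is a set $D$ of vertices such that every vertex outside $D$ has a neighbor in $D$. The diamond is the graph on $4$ vertices with $5$ edges ($K_4$ minus one edge). A graph $G$ is called irreducible if it contains no $K_4$ as an induced subgraph, contains no induced diamond, and has no two distinct vertices $u,v$ with $N(u)\subseteq N(v)$. -}

module Defs where

open import Data.Nat using (ℕ; zero; suc; _+_; _*_; _≤_; pred)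
open import Data.Bool using (Bool; true; false; if_then_else_)
open import Data.Fin using (Fin)
open import Data.Fin.Subset using (Subset; _∈_; ∣_∣)
open import Data.List using (List; map; allFin)
open import Data.Nat.ListAction using (sum)
open import Data.Empty using (⊥)
open import Data.Product using (Σ; _×_; ∃; ∃-syntax; _,_)
open import Data.Sum using (_⊎_)
open import Relation.Nullary using (¬_)
open import Relation.Binary.PropositionalEquality using (_≡_; _≢_)

record Graph (m : ℕ) : Set where
  field
    E     : Fin m → Fin m → Bool
    sym   : ∀ u v → E u v ≡ E v u
    irref : ∀ u → E u u ≡ false

module _ {m : ℕ} (G : Graph m) where
  open Graph G

  Adj : Fin m → Fin m → Set
  Adj u v = E u v ≡ true

  NbhdSubset : Fin m → Fin m → Set
  NbhdSubset u v = ∀ w → Adj u w → Adj v w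

  -- four distinct pairwise adjacent vertices (induced K4 = K4 subgraph)
  HasInducedK4 : Set
  HasInducedK4 = Σ (Fin m) λ a → Σ (Fin m) λ b → Σ (Fin m) λ c → Σ (Fin m) λ d →
    (a ≢ b) × (a ≢ c) × (a ≢ d) × (b ≢ c) × (b ≢ d) × (c ≢ d) ×
    Adj a b × Adj a c × Adj a d × Adj b c × Adj b d × Adj c d

  HasInducedDiamond : Set
  HasInducedDiamond = Σ (Fin m) λ a → Σ (Fin m) λ b → Σ (Fin m) λ c → Σ (Fin m) λ d →
    (a ≢ b) × (a ≢ c) × (a ≢ d) × (b ≢ c) × (b ≢ d) × (c ≢ d) ×
    Adj a b × Adj a c × Adj a d × Adj b c × Adj b d × ¬ Adj c d

  Irreducible : Set
  Irreducible = ¬ HasInducedK4 × ¬ HasInducedDiamond ×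
    (∀ u v → u ≢ v → ¬ NbhdSubset u v)

  TriangleFree : Set
  TriangleFree = ∀ a b c → Adj a b → Adj b c → Adj a c → ⊥

  Colorable : ℕ → Set
  Colorable k = Σ (Fin m → Fin k) λ col → ∀ u v → Adj u v → col u ≢ col v

  WithinDist : ℕ → Fin m → Fin m → Set
  WithinDist zero    u v = u ≡ v
  WithinDist (suc k) u v = u ≡ v ⊎ Σ (Fin m) λ w → Adj u w × WithinDist k w v

  HasDiameter : ℕ → Set
  HasDiameter d = (∀ u v → WithinDist d u v) ×
    (d ≡ 0 ⊎ Σ (Fin m) λ u → Σ (Fin m) λ v → ¬ WithinDist (pred d) u v)

  degree : Fin m → ℕ
  degree u = sum (map (λ v → if E u v then 1 else 0) (allFin m))

  HasMinDegree : ℕ → Set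
  HasMinDegree δ = (∀ u → δ ≤ degree u) × (Σ (Fin m) λ u → degree u ≡ δ)

  Dominating : Subset m → Set
  Dominating D = ∀ v → v ∈ D ⊎ (Σ (Fin m) λ w → w ∈ D × Adj v w)

  HasDominationNumber : ℕ → Set
  HasDominationNumber k = (Σ (Subset m) λ D → Dominating D × ∣ D ∣ ≡ k) ×
    (∀ D → Dominating D → k ≤ ∣ D ∣)

module Submission where

-- The graph for parameter t has as vertices three copies X, Y, Z of the R × C grid (R = t + 3, C = t + 5)
-- and a hub H: X(i,j) ~ Y(a,b) when the cells are distinct but share a row or a column (rook adjacency),
-- X(i,j) ~ Z(i,j), Y(a,b) ~ Z(c,d) when the cells are equal or share neither row nor column, and H ~ every Y.
-- The only candidate triangles X(i,j) Y(a,b) Z(i,j) would need (a,b) to be both rook-adjacent and not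
-- rook-adjacent to (i,j), so the graph is triangle-free (hence has no K4 and no diamond); colouring X and H
-- alike, Y and Z by themselves, is proper. Short case analyses give diameter 2 and, for any two vertices u ≠ v,
-- a neighbour of u that is not a neighbour of v. The X-vertices attain the minimum degree R + C - 1, while H
-- together with one column of Y's is a smallest dominating set, of size R + 1. With t + 1 = ⌊√n⌋ the order,
-- δ² and γ² all lie between n and 50 n.

open import Defs
open import Data.Nat using (ℕ; zero; suc; _+_; _*_; _≤_; _<_; z≤n; s≤s)
open import Data.Nat.Properties
  using (≤-trans; ≤-antisym; ≤-reflexive; <⇒≤; <⇒≱; ≮⇒≥; _<?_; ≤-<-trans; +-suc; +-monoʳ-≤; *-mono-≤; *-monoʳ-≤;
         *-mono-<; *-identityˡ; m≤m+n; m≤n+m; n≤1+n; m≤n⇒m≤1+n; n<1+n; m+n≤o⇒m≤o)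
open import Data.Nat.Tactic.RingSolver using (solve-∀)
open import Data.Bool using (Bool; true; false; if_then_else_)
open import Data.Fin using (Fin; zero; suc; splitAt; join; punchIn; punchOut; _↑ˡ_; _↑ʳ_)
open import Data.Fin.Properties
  using (_≟_; suc-injective; 0≢1+n; join-splitAt; punchIn-injective; punchInᵢ≢i; punchIn-punchOut;
         all?; any?; ¬∀⟶∃¬; +↔⊎; *↔×; 1↔⊤)
open import Data.Fin.Subset using (Subset; _∈_; ∣_∣; ⁅_⁆; _∪_; _-_)
open import Data.Fin.Subset.Properties
  using (_∈?_; x∈p∧x∉q⇒x∈p─q; x∈⁅y⁆⇒x≡y; x∈p⇒∣p-x∣<∣p∣; p⊆q⇒∣p∣≤∣q∣; ∣⊥∣≡0; ∣⁅x⁆∣≡1; ∣p∣≤∣x∷p∣; x∈⁅x⁆;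
         p⊆p∪q; q⊆p∪q)
open import Data.List using (map; allFin)
import Data.List as List
open import Data.List.Properties using (map-tabulate)
open import Data.Nat.ListAction using (sum)
open import Data.Product using (Σ; ∃; _×_; _,_; proj₁; proj₂)
open import Data.Sum using (_⊎_; inj₁; inj₂; [_,_]′)
open import Data.Sum.Function.Propositional using (_⊎-↔_)
open import Data.Unit using (⊤; tt)
open import Data.Empty using (⊥; ⊥-elim)
open import Function using (_∘_; case_of_)
open import Function.Bundles using (_↔_; Inverse; mk↔ₛ′)
open import Function.Definitions using (Injective)
open import Function.Properties.Inverse using (↔-trans)
open import Relation.Nullary using (¬_; Dec; yes; no; does; contradiction)
open import Relation.Nullary.Decidable using (dec-true; dec-false; _×-dec_; _⊎-dec_; ¬?)
open import Relation.Binary.PropositionalEquality using (_≡_; _≢_; refl; sym; trans; cong; subst; subst₂; ≢-sym)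

module FiniteSubsets where

  open import Data.Vec using ([]; _∷_; tabulate)
  open import Data.Vec.Properties using (lookup∘tabulate; []=⇒lookup; lookup⇒[]=)
  open import Data.Fin.Subset using (inside; outside) renaming (⊥ to ∅)

  private variable k n : ℕ

  ∣p∪q∣≤∣p∣+∣q∣ : (p q : Subset n) → ∣ p ∪ q ∣ ≤ ∣ p ∣ + ∣ q ∣
  ∣p∪q∣≤∣p∣+∣q∣ []            []      = z≤n
  ∣p∪q∣≤∣p∣+∣q∣ (inside  ∷ p) (x ∷ q) =
    s≤s (≤-trans (∣p∪q∣≤∣p∣+∣q∣ p q) (+-monoʳ-≤ ∣ p ∣ (∣p∣≤∣x∷p∣ x q)))
  ∣p∪q∣≤∣p∣+∣q∣ (outside ∷ p) (inside ∷ q) =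
    subst (suc ∣ p ∪ q ∣ ≤_) (sym (+-suc ∣ p ∣ ∣ q ∣)) (s≤s (∣p∪q∣≤∣p∣+∣q∣ p q))
  ∣p∪q∣≤∣p∣+∣q∣ (outside ∷ p) (outside ∷ q) = ∣p∪q∣≤∣p∣+∣q∣ p q

  image : (Fin k → Fin n) → Subset n
  image {zero}  g = ∅
  image {suc k} g = ⁅ g zero ⁆ ∪ image (g ∘ suc)

  ∣image∣≤ : (g : Fin k → Fin n) → ∣ image g ∣ ≤ k
  ∣image∣≤ {zero} {n} g = subst (_≤ 0) (sym (∣⊥∣≡0 n)) z≤n
  ∣image∣≤ {suc k} g = ≤-trans (∣p∪q∣≤∣p∣+∣q∣ ⁅ g zero ⁆ _)
    (subst (λ z → z + ∣ image (g ∘ suc) ∣ ≤ suc k) (sym (∣⁅x⁆∣≡1 (g zero))) (s≤s (∣image∣≤ (g ∘ suc))))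

  ∈-image : (g : Fin k → Fin n) (i : Fin k) → g i ∈ image g
  ∈-image g zero    = p⊆p∪q {p = ⁅ g zero ⁆} _ (x∈⁅x⁆ (g zero))
  ∈-image g (suc i) = q⊆p∪q ⁅ g zero ⁆ _ (∈-image (g ∘ suc) i)

  injective⇒≤∣p∣ : ∀ {p : Subset n} (g : Fin k → Fin n) → Injective _≡_ _≡_ g → (∀ i → g i ∈ p) → k ≤ ∣ p ∣
  injective⇒≤∣p∣ {k = zero}  g g-inj g∈p = z≤n
  injective⇒≤∣p∣ {k = suc k} {p = p} g g-inj g∈p =
    ≤-trans (s≤s (injective⇒≤∣p∣ (g ∘ suc) (suc-injective ∘ g-inj) g∘suc∈p-g₀)) (x∈p⇒∣p-x∣<∣p∣ (g∈p zero))
    where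
    g∘suc∈p-g₀ : ∀ i → g (suc i) ∈ p - g zero
    g∘suc∈p-g₀ i = x∈p∧x∉q⇒x∈p─q (g∈p (suc i)) (λ gᵢ∈⁅g₀⁆ → 0≢1+n (sym (g-inj (x∈⁅y⁆⇒x≡y (g zero) gᵢ∈⁅g₀⁆))))

  covering⇒∣p∣≤ : ∀ {p : Subset n} (g : Fin k → Fin n) → (∀ {x} → x ∈ p → ∃ λ i → g i ≡ x) → ∣ p ∣ ≤ k
  covering⇒∣p∣≤ g covers = ≤-trans (p⊆q⇒∣p∣≤∣q∣ p⊆image) (∣image∣≤ g)
    where
    p⊆image : ∀ {x} → x ∈ _ → x ∈ image g
    p⊆image x∈p with covers x∈p
    ... | i , refl = ∈-image g i

  ⟦_⟧ : (Fin n → Bool) → Subset n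
  ⟦ f ⟧ = tabulate f

  ∈⟦⟧⁺ : ∀ (f : Fin n → Bool) {x} → f x ≡ true → x ∈ ⟦ f ⟧
  ∈⟦⟧⁺ f {x} fx≡true = lookup⇒[]= x (tabulate f) (trans (lookup∘tabulate f x) fx≡true)

  ∈⟦⟧⁻ : ∀ (f : Fin n → Bool) {x} → x ∈ ⟦ f ⟧ → f x ≡ true
  ∈⟦⟧⁻ f {x} x∈⟦f⟧ = trans (sym (lookup∘tabulate f x)) ([]=⇒lookup x∈⟦f⟧)

  count≡∣⟦⟧∣ : (f : Fin n → Bool) → sum (map (λ v → if f v then 1 else 0) (allFin n)) ≡ ∣ ⟦ f ⟧ ∣
  count≡∣⟦⟧∣ f = trans (cong sum (map-tabulate (λ x → x) (λ v → if f v then 1 else 0))) (go f)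
    where
    go : ∀ {n} (f : Fin n → Bool) → sum (List.tabulate (λ v → if f v then 1 else 0)) ≡ ∣ ⟦ f ⟧ ∣
    go {zero}  f = refl
    go {suc n} f with f zero
    ... | true  = cong suc (go (f ∘ suc))
    ... | false = go (f ∘ suc)

open import Data.Vec.Functional using (Vector; _∷_; _++_)
open import Data.Vec.Functional.Properties using (lookup-++ˡ; lookup-++ʳ)

open FiniteSubsets

module _ {m : ℕ} (G : Graph m) where

  triangleFree⇒¬K4 : TriangleFree G → ¬ HasInducedK4 G
  triangleFree⇒¬K4 noTriangle (a , b , c , _ , _ , _ , _ , _ , _ , _ , ab , ac , _ , bc , _ , _) =
    noTriangle a b c ab bc ac

  triangleFree⇒¬diamond : TriangleFree G → ¬ HasInducedDiamond G
  triangleFree⇒¬diamond noTriangle (a , b , c , _ , _ , _ , _ , _ , _ , _ , ab , ac , _ , bc , _ , _) =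
    noTriangle a b c ab bc ac

module RelationGraph {m : ℕ} {V : Set} (code : Fin m ↔ V)
  {_~_ : V → V → Set} (_~?_ : ∀ a b → Dec (a ~ b))
  (~-sym : ∀ {a b} → a ~ b → b ~ a) (~-irrefl : ∀ a → ¬ a ~ a) where

  open Inverse code public using (to; from)
  open Inverse code using (strictlyInverseˡ; strictlyInverseʳ)

  private variable
    k : ℕ
    u v : Fin m

  graph : Graph m
  graph = record
    { E     = λ u v → does (to u ~? to v)
    ; sym   = E-sym
    ; irref = λ u → dec-false (to u ~? to u) (~-irrefl (to u))
    }
    where
    E-sym : ∀ u v → does (to u ~? to v) ≡ does (to v ~? to u)
    E-sym u v with to v ~? to u
    ... | yes vu = dec-true (to u ~? to v) (~-sym vu)
    ... | no ¬vu = dec-false (to u ~? to v) (¬vu ∘ ~-sym)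

  to-injective : to u ≡ to v → u ≡ v
  to-injective {u} {v} eq = trans (sym (strictlyInverseʳ u)) (trans (cong from eq) (strictlyInverseʳ v))

  from-injective : Injective _≡_ _≡_ from
  from-injective {a} {b} eq = trans (sym (strictlyInverseˡ a)) (trans (cong to eq) (strictlyInverseˡ b))

  Adj⇒~ : Adj graph u v → to u ~ to v
  Adj⇒~ {u} {v} uv with to u ~? to v
  ... | yes p = p

  ~⇒Adj : to u ~ to v → Adj graph u v
  ~⇒Adj {u} {v} = dec-true (to u ~? to v)

  ~⇒Adj-from : ∀ {b} → to u ~ b → Adj graph u (from b)
  ~⇒Adj-from {b = b} p = ~⇒Adj (subst (_ ~_) (sym (strictlyInverseˡ b)) p)

  Adj-from⇒~ : ∀ {a b} → Adj graph (from a) (from b) → a ~ b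
  Adj-from⇒~ {a} {b} ab = subst₂ _~_ (strictlyInverseˡ a) (strictlyInverseˡ b) (Adj⇒~ ab)

  triangleFree : (∀ {a b c} → a ~ b → b ~ c → a ~ c → ⊥) → TriangleFree graph
  triangleFree noTriangle u v w uv vw uw = noTriangle (Adj⇒~ uv) (Adj⇒~ vw) (Adj⇒~ uw)

  colorable : (col : V → Fin k) → (∀ {a b} → a ~ b → col a ≢ col b) → Colorable graph k
  colorable col proper = col ∘ to , λ u v uv → proper (Adj⇒~ uv)

  noNbhdSubset : (∀ {a b} → a ≢ b → ∃ λ w → a ~ w × ¬ b ~ w) → ∀ u v → u ≢ v → ¬ NbhdSubset graph u v
  noNbhdSubset private-nbr u v u≢v N[u]⊆N[v] with private-nbr (u≢v ∘ to-injective)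
  ... | w , uw , ¬vw = ¬vw (subst (_ ~_) (strictlyInverseˡ w) (Adj⇒~ (N[u]⊆N[v] (from w) (~⇒Adj-from uw))))

  WithinTwo : V → V → Set
  WithinTwo a b = a ≡ b ⊎ a ~ b ⊎ ∃ λ c → a ~ c × c ~ b

  WithinTwo-sym : ∀ {a b} → WithinTwo a b → WithinTwo b a
  WithinTwo-sym (inj₁ a≡b)                 = inj₁ (sym a≡b)
  WithinTwo-sym (inj₂ (inj₁ ab))           = inj₂ (inj₁ (~-sym ab))
  WithinTwo-sym (inj₂ (inj₂ (c , ac , cb))) = inj₂ (inj₂ (c , ~-sym cb , ~-sym ac))

  hasDiameter2 : (∀ a b → WithinTwo a b) → ∀ {a b} → a ≢ b → ¬ a ~ b → HasDiameter graph 2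
  hasDiameter2 withinTwo {a} {b} a≢b ¬ab = within , inj₂ (from a , from b , farApart)
    where
    within : ∀ u v → WithinDist graph 2 u v
    within u v with withinTwo (to u) (to v)
    ... | inj₁ u≡v                 = inj₁ (to-injective u≡v)
    ... | inj₂ (inj₁ uv)           = inj₂ (v , ~⇒Adj uv , inj₁ refl)
    ... | inj₂ (inj₂ (c , uc , cv)) =
      inj₂ (from c , ~⇒Adj-from uc , inj₂ (v , ~⇒Adj (subst (_~ _) (sym (strictlyInverseˡ c)) cv) , refl))
    farApart : ¬ WithinDist graph 1 (from a) (from b)
    farApart (inj₁ eq)            = a≢b (from-injective eq)
    farApart (inj₂ (_ , ab , refl)) = ¬ab (Adj-from⇒~ ab)

  ≤degree : (f : Fin k → V) → Injective _≡_ _≡_ f → (∀ i → to u ~ f i) → k ≤ degree graph u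
  ≤degree {u = u} f f-inj u~f = subst (_ ≤_) (sym (count≡∣⟦⟧∣ (Graph.E graph u)))
    (injective⇒≤∣p∣ (from ∘ f) (f-inj ∘ from-injective) (λ i → ∈⟦⟧⁺ (Graph.E graph u) (~⇒Adj-from (u~f i))))

  degree≤ : ∀ {a} (f : Fin k → V) → (∀ {b} → a ~ b → ∃ λ i → f i ≡ b) → degree graph (from a) ≤ k
  degree≤ {a = a} f covers = subst (_≤ _) (sym (count≡∣⟦⟧∣ (Graph.E graph (from a))))
    (covering⇒∣p∣≤ (from ∘ f) λ {v} v∈N → let i , fi≡tov = covers (a~ (∈⟦⟧⁻ (Graph.E graph (from a)) v∈N)) in
      i , trans (cong from fi≡tov) (strictlyInverseʳ v))
    where
    a~ : Adj graph (from a) v → a ~ to v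
    a~ = subst (_~ _) (strictlyInverseˡ a) ∘ Adj⇒~

  vertexSet : (V → Bool) → Subset m
  vertexSet P = ⟦ P ∘ to ⟧

  ∈vertexSet⁺ : ∀ {P a} → P a ≡ true → from a ∈ vertexSet P
  ∈vertexSet⁺ {P} {a} Pa = ∈⟦⟧⁺ (P ∘ to) (trans (cong P (strictlyInverseˡ a)) Pa)

  dominating : ∀ {P} → (∀ a → P a ≡ true ⊎ ∃ λ b → P b ≡ true × a ~ b) → Dominating graph (vertexSet P)
  dominating {P} dom v with dom (to v)
  ... | inj₁ Pv            = inj₁ (∈⟦⟧⁺ (P ∘ to) Pv)
  ... | inj₂ (w , Pw , vw) = inj₂ (from w , ∈vertexSet⁺ Pw , ~⇒Adj-from vw)

  dominated : ∀ {D} → Dominating graph D → ∀ a → from a ∈ D ⊎ ∃ λ b → from b ∈ D × a ~ b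
  dominated dom a with dom (from a)
  ... | inj₁ a∈D             = inj₁ a∈D
  ... | inj₂ (w , w∈D , aw) = inj₂ (to w , subst (_∈ _) (sym (strictlyInverseʳ w)) w∈D ,
                                    subst (_~ _) (strictlyInverseˡ a) (Adj⇒~ aw))

  ≤∣D∣ : ∀ {D} (f : Fin k → V) → Injective _≡_ _≡_ f → (∀ i → from (f i) ∈ D) → k ≤ ∣ D ∣
  ≤∣D∣ f f-inj = injective⇒≤∣p∣ (from ∘ f) (f-inj ∘ from-injective)

  ∣vertexSet∣≡ : ∀ {P} (f : Fin k → V) → Injective _≡_ _≡_ f → (∀ i → P (f i) ≡ true) →
                 (∀ {a} → P a ≡ true → ∃ λ i → f i ≡ a) → ∣ vertexSet P ∣ ≡ k
  ∣vertexSet∣≡ {P = P} f f-inj P∘f enumerates = ≤-antisym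
    (covering⇒∣p∣≤ (from ∘ f) λ {v} v∈ → let i , fi≡tov = enumerates (∈⟦⟧⁻ (P ∘ to) v∈) in
      i , trans (cong from fi≡tov) (strictlyInverseʳ v))
    (≤∣D∣ f f-inj (λ i → ∈vertexSet⁺ {P} (P∘f i)))

module _ {A : Set} where

  private variable m n : ℕ

  ∷-injective : ∀ {x} {f : Vector A n} → Injective _≡_ _≡_ f → (∀ i → f i ≢ x) → Injective _≡_ _≡_ (x ∷ f)
  ∷-injective f-inj x∉f {zero}  {zero}  _  = refl
  ∷-injective f-inj x∉f {zero}  {suc j} eq = ⊥-elim (x∉f j (sym eq))
  ∷-injective f-inj x∉f {suc i} {zero}  eq = ⊥-elim (x∉f i eq)
  ∷-injective f-inj x∉f {suc i} {suc j} eq = cong suc (f-inj eq)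

  ++-injective : {f : Vector A m} {g : Vector A n} → Injective _≡_ _≡_ f → Injective _≡_ _≡_ g →
                 (∀ i j → f i ≢ g j) → Injective _≡_ _≡_ (f ++ g)
  ++-injective {m} {n} {f} {g} f-inj g-inj disjoint {k} {k′} eq =
    trans (sym (join-splitAt m n k)) (trans (cong (join m n) (split-injective (splitAt m k) (splitAt m k′) eq))
      (join-splitAt m n k′))
    where
    split-injective : ∀ s s′ → [ f , g ]′ s ≡ [ f , g ]′ s′ → s ≡ s′
    split-injective (inj₁ i) (inj₁ i′) eq = cong inj₁ (f-inj eq)
    split-injective (inj₁ i) (inj₂ j)  eq = ⊥-elim (disjoint i j eq)
    split-injective (inj₂ j) (inj₁ i)  eq = ⊥-elim (disjoint i j (sym eq))
    split-injective (inj₂ j) (inj₂ j′) eq = cong inj₂ (g-inj eq)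

  ∀-∷ : ∀ {P : A → Set} {x} {f : Vector A n} → P x → (∀ i → P (f i)) → ∀ i → P ((x ∷ f) i)
  ∀-∷ Px Pf zero    = Px
  ∀-∷ Px Pf (suc i) = Pf i

  ∀-++ : ∀ {P : A → Set} {f : Vector A m} {g : Vector A n} → (∀ i → P (f i)) → (∀ j → P (g j)) →
         ∀ k → P ((f ++ g) k)
  ∀-++ {m} Pf Pg k with splitAt m k
  ... | inj₁ i = Pf i
  ... | inj₂ j = Pg j

∃≢ : ∀ {n} (a : Fin (suc (suc n))) → ∃ λ c → c ≢ a
∃≢ a = punchIn a zero , punchInᵢ≢i a zero

∃≢₂ : ∀ {n} (a b : Fin (suc (suc (suc n)))) → ∃ λ c → c ≢ a × c ≢ b
∃≢₂ a b with a ≟ b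
... | yes refl = punchIn a zero , punchInᵢ≢i a zero , punchInᵢ≢i a zero
... | no a≢b   = punchIn a (punchIn (punchOut a≢b) zero) , punchInᵢ≢i a _ ,
  λ eq → punchInᵢ≢i (punchOut a≢b) zero (punchIn-injective a _ _ (trans eq (sym (punchIn-punchOut a≢b))))

module Construction (t : ℕ) where

  R C : ℕ
  R = 3 + t
  C = 2 + R

  data Vertex : Set where
    X Y Z : Fin R → Fin C → Vertex
    H     : Vertex

  Rook NonRook Same : Fin R → Fin C → Fin R → Fin C → Set
  Rook    i j a b = (i ≡ a × j ≢ b) ⊎ (i ≢ a × j ≡ b)
  NonRook i j a b = (i ≡ a × j ≡ b) ⊎ (i ≢ a × j ≢ b)
  Same    i j a b = i ≡ a × j ≡ b

  infix 4 _~_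
  _~_ : Vertex → Vertex → Set
  X i j ~ Y a b = Rook i j a b
  Y a b ~ X i j = Rook i j a b
  X i j ~ Z a b = Same i j a b
  Z a b ~ X i j = Same i j a b
  Y i j ~ Z a b = NonRook i j a b
  Z a b ~ Y i j = NonRook i j a b
  Y _ _ ~ H     = ⊤
  H     ~ Y _ _ = ⊤
  X _ _ ~ X _ _ = ⊥
  X _ _ ~ H     = ⊥
  Y _ _ ~ Y _ _ = ⊥
  Z _ _ ~ Z _ _ = ⊥
  Z _ _ ~ H     = ⊥
  H     ~ X _ _ = ⊥
  H     ~ Z _ _ = ⊥
  H     ~ H     = ⊥

  _~?_ : ∀ u v → Dec (u ~ v)
  X i j ~? Y a b = ((i ≟ a) ×-dec ¬? (j ≟ b)) ⊎-dec (¬? (i ≟ a) ×-dec (j ≟ b))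
  Y a b ~? X i j = X i j ~? Y a b
  X i j ~? Z a b = (i ≟ a) ×-dec (j ≟ b)
  Z a b ~? X i j = X i j ~? Z a b
  Y i j ~? Z a b = ((i ≟ a) ×-dec (j ≟ b)) ⊎-dec (¬? (i ≟ a) ×-dec ¬? (j ≟ b))
  Z a b ~? Y i j = Y i j ~? Z a b
  Y _ _ ~? H     = yes tt
  H     ~? Y _ _ = yes tt
  X _ _ ~? X _ _ = no λ ()
  X _ _ ~? H     = no λ ()
  Y _ _ ~? Y _ _ = no λ ()
  Z _ _ ~? Z _ _ = no λ ()
  Z _ _ ~? H     = no λ ()
  H     ~? X _ _ = no λ ()
  H     ~? Z _ _ = no λ ()
  H     ~? H     = no λ ()

  ~-sym : ∀ {u v} → u ~ v → v ~ u
  ~-sym {X _ _} {Y _ _} p = p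
  ~-sym {Y _ _} {X _ _} p = p
  ~-sym {X _ _} {Z _ _} p = p
  ~-sym {Z _ _} {X _ _} p = p
  ~-sym {Y _ _} {Z _ _} p = p
  ~-sym {Z _ _} {Y _ _} p = p
  ~-sym {Y _ _} {H}     p = p
  ~-sym {H}     {Y _ _} p = p

  ~-irrefl : ∀ u → ¬ u ~ u
  ~-irrefl (X _ _) ()
  ~-irrefl (Y _ _) ()
  ~-irrefl (Z _ _) ()
  ~-irrefl H ()

  m : ℕ
  m = R * C + (R * C + (R * C + 1))

  code : Fin m ↔ Vertex
  code = ↔-trans blocks cases
    where
    Cell : Set
    Cell = Fin R × Fin C
    blocks : Fin m ↔ (Cell ⊎ Cell ⊎ Cell ⊎ ⊤)
    blocks = ↔-trans +↔⊎ (*↔× ⊎-↔ ↔-trans +↔⊎ (*↔× ⊎-↔ ↔-trans +↔⊎ (*↔× ⊎-↔ 1↔⊤)))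
    to : Cell ⊎ Cell ⊎ Cell ⊎ ⊤ → Vertex
    to (inj₁ (i , j))               = X i j
    to (inj₂ (inj₁ (i , j)))        = Y i j
    to (inj₂ (inj₂ (inj₁ (i , j)))) = Z i j
    to (inj₂ (inj₂ (inj₂ tt)))      = H
    from : Vertex → Cell ⊎ Cell ⊎ Cell ⊎ ⊤
    from (X i j) = inj₁ (i , j)
    from (Y i j) = inj₂ (inj₁ (i , j))
    from (Z i j) = inj₂ (inj₂ (inj₁ (i , j)))
    from H       = inj₂ (inj₂ (inj₂ tt))
    cases : (Cell ⊎ Cell ⊎ Cell ⊎ ⊤) ↔ Vertex
    cases = mk↔ₛ′ to from (λ { (X _ _) → refl ; (Y _ _) → refl ; (Z _ _) → refl ; H → refl })
      λ { (inj₁ _) → refl ; (inj₂ (inj₁ _)) → refl ; (inj₂ (inj₂ (inj₁ _))) → refl ; (inj₂ (inj₂ (inj₂ tt))) → refl }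

  open RelationGraph code _~?_ ~-sym ~-irrefl public

  rook⇒¬nonRook : ∀ {i j a b} → Rook i j a b → ¬ NonRook a b i j
  rook⇒¬nonRook (inj₁ (refl , j≢b)) (inj₁ (_ , b≡j)) = j≢b (sym b≡j)
  rook⇒¬nonRook (inj₁ (refl , _))   (inj₂ (a≢i , _)) = a≢i refl
  rook⇒¬nonRook (inj₂ (i≢a , refl)) (inj₁ (a≡i , _)) = i≢a (sym a≡i)
  rook⇒¬nonRook (inj₂ (_ , refl))   (inj₂ (_ , b≢j)) = b≢j refl

  private variable
    i j a b : Fin _
    w : Vertex

  noCommonNeighbour-XY : Rook i j a b → X i j ~ w → Y a b ~ w → ⊥
  noCommonNeighbour-XY {w = Z _ _} xy (refl , refl) yz = rook⇒¬nonRook xy yz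
  noCommonNeighbour-XY {w = X _ _} _ () _
  noCommonNeighbour-XY {w = Y _ _} _ _ ()
  noCommonNeighbour-XY {w = H}     _ () _

  noCommonNeighbour-XZ : Same i j a b → X i j ~ w → Z a b ~ w → ⊥
  noCommonNeighbour-XZ {w = Y _ _} (refl , refl) xy zy = rook⇒¬nonRook xy zy
  noCommonNeighbour-XZ {w = X _ _} _ () _
  noCommonNeighbour-XZ {w = Z _ _} _ _ ()
  noCommonNeighbour-XZ {w = H}     _ () _

  noCommonNeighbour-YZ : NonRook i j a b → Y i j ~ w → Z a b ~ w → ⊥
  noCommonNeighbour-YZ {w = X _ _} yz yx (refl , refl) = rook⇒¬nonRook yx yz
  noCommonNeighbour-YZ {w = Y _ _} _ () _
  noCommonNeighbour-YZ {w = Z _ _} _ _ ()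
  noCommonNeighbour-YZ {w = H}     _ _ ()

  noCommonNeighbour-YH : Y a b ~ w → H ~ w → ⊥
  noCommonNeighbour-YH {w = X _ _} _ ()
  noCommonNeighbour-YH {w = Y _ _} ()
  noCommonNeighbour-YH {w = Z _ _} _ ()
  noCommonNeighbour-YH {w = H}     _ ()

  noTriangle : ∀ {u v w} → u ~ v → v ~ w → u ~ w → ⊥
  noTriangle {X _ _} {Y _ _} xy yw xw = noCommonNeighbour-XY xy xw yw
  noTriangle {Y _ _} {X _ _} yx xw yw = noCommonNeighbour-XY yx xw yw
  noTriangle {X _ _} {Z _ _} xz zw xw = noCommonNeighbour-XZ xz xw zw
  noTriangle {Z _ _} {X _ _} zx xw zw = noCommonNeighbour-XZ zx xw zw
  noTriangle {Y _ _} {Z _ _} yz zw yw = noCommonNeighbour-YZ yz yw zw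
  noTriangle {Z _ _} {Y _ _} zy yw zw = noCommonNeighbour-YZ zy yw zw
  noTriangle {Y _ _} {H}     _  hw yw = noCommonNeighbour-YH yw hw
  noTriangle {H}     {Y _ _} _  yw hw = noCommonNeighbour-YH yw hw
  noTriangle {X _ _} {X _ _} ()
  noTriangle {X _ _} {H}     ()
  noTriangle {Y _ _} {Y _ _} ()
  noTriangle {Z _ _} {Z _ _} ()
  noTriangle {Z _ _} {H}     ()
  noTriangle {H}     {X _ _} ()
  noTriangle {H}     {Z _ _} ()
  noTriangle {H}     {H}     ()

  colour : Vertex → Fin 3
  colour (X _ _) = zero
  colour (Y _ _) = suc zero
  colour (Z _ _) = suc (suc zero)
  colour H       = zero

  colour-proper : ∀ {u v} → u ~ v → colour u ≢ colour v
  colour-proper {X _ _} {Y _ _} _ ()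
  colour-proper {Y _ _} {X _ _} _ ()
  colour-proper {X _ _} {Z _ _} _ ()
  colour-proper {Z _ _} {X _ _} _ ()
  colour-proper {Y _ _} {Z _ _} _ ()
  colour-proper {Z _ _} {Y _ _} _ ()
  colour-proper {Y _ _} {H}     _ ()
  colour-proper {H}     {Y _ _} _ ()

  private
    via : ∀ {u v} c → u ~ c → c ~ v → WithinTwo u v
    via c uc cv = inj₂ (inj₂ (c , uc , cv))

    adjacent : ∀ {u v} → u ~ v → WithinTwo u v
    adjacent uv = inj₂ (inj₁ uv)

  withinTwo-XX : ∀ i j a b → WithinTwo (X i j) (X a b)
  withinTwo-XX i j a b with i ≟ a | j ≟ b
  ... | yes refl | yes refl = inj₁ refl
  ... | yes refl | no j≢b   = let c , c≢j , c≢b = ∃≢₂ j b in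
    via (Y i c) (inj₁ (refl , ≢-sym c≢j)) (inj₁ (refl , ≢-sym c≢b))
  ... | no i≢a   | yes refl = let r , r≢i , r≢a = ∃≢₂ i a in
    via (Y r j) (inj₂ (≢-sym r≢i , refl)) (inj₂ (≢-sym r≢a , refl))
  ... | no i≢a   | no j≢b   = via (Y i b) (inj₁ (refl , j≢b)) (inj₂ (≢-sym i≢a , refl))

  withinTwo-YY : ∀ i j a b → WithinTwo (Y i j) (Y a b)
  withinTwo-YY i j a b with i ≟ a | j ≟ b
  ... | yes refl | yes refl = inj₁ refl
  ... | yes refl | no j≢b   = let c , c≢j , c≢b = ∃≢₂ j b in
    via (X i c) (inj₁ (refl , c≢j)) (inj₁ (refl , c≢b))
  ... | no i≢a   | yes refl = let r , r≢i , r≢a = ∃≢₂ i a in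
    via (X r j) (inj₂ (r≢i , refl)) (inj₂ (r≢a , refl))
  ... | no i≢a   | no j≢b   = via (X i b) (inj₁ (refl , ≢-sym j≢b)) (inj₂ (i≢a , refl))

  withinTwo-ZZ : ∀ i j a b → WithinTwo (Z i j) (Z a b)
  withinTwo-ZZ i j a b = let r , r≢i , r≢a = ∃≢₂ i a ; c , c≢j , c≢b = ∃≢₂ j b in
    via (Y r c) (inj₂ (r≢i , c≢j)) (inj₂ (r≢a , c≢b))

  withinTwo-XY : ∀ i j a b → WithinTwo (X i j) (Y a b)
  withinTwo-XY i j a b with i ≟ a | j ≟ b
  ... | yes refl | yes refl = via (Z i j) (refl , refl) (inj₁ (refl , refl))
  ... | yes refl | no j≢b   = adjacent (inj₁ (refl , j≢b))
  ... | no i≢a   | yes refl = adjacent (inj₂ (i≢a , refl))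
  ... | no i≢a   | no j≢b   = via (Z i j) (refl , refl) (inj₂ (≢-sym i≢a , ≢-sym j≢b))

  withinTwo-XZ : ∀ i j a b → WithinTwo (X i j) (Z a b)
  withinTwo-XZ i j a b with i ≟ a | j ≟ b
  ... | yes refl | yes refl = adjacent (refl , refl)
  ... | yes refl | no j≢b   = via (Y a b) (inj₁ (refl , j≢b)) (inj₁ (refl , refl))
  ... | no i≢a   | yes refl = via (Y a b) (inj₂ (i≢a , refl)) (inj₁ (refl , refl))
  ... | no i≢a   | no j≢b   = let c , c≢j , c≢b = ∃≢₂ j b in
    via (Y i c) (inj₁ (refl , ≢-sym c≢j)) (inj₂ (i≢a , c≢b))

  withinTwo-YZ : ∀ i j a b → WithinTwo (Y i j) (Z a b)
  withinTwo-YZ i j a b with i ≟ a | j ≟ b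
  ... | yes refl | yes refl = adjacent (inj₁ (refl , refl))
  ... | yes refl | no j≢b   = via (X a b) (inj₁ (refl , ≢-sym j≢b)) (refl , refl)
  ... | no i≢a   | yes refl = via (X a b) (inj₂ (≢-sym i≢a , refl)) (refl , refl)
  ... | no i≢a   | no j≢b   = adjacent (inj₂ (i≢a , j≢b))

  withinTwo : ∀ u v → WithinTwo u v
  withinTwo (X i j) (X a b) = withinTwo-XX i j a b
  withinTwo (X i j) (Y a b) = withinTwo-XY i j a b
  withinTwo (X i j) (Z a b) = withinTwo-XZ i j a b
  withinTwo (X i j) H       = let c , c≢j = ∃≢ j in via (Y i c) (inj₁ (refl , ≢-sym c≢j)) tt
  withinTwo (Y i j) (X a b) = WithinTwo-sym (withinTwo-XY a b i j)
  withinTwo (Y i j) (Y a b) = withinTwo-YY i j a b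
  withinTwo (Y i j) (Z a b) = withinTwo-YZ i j a b
  withinTwo (Y i j) H       = adjacent tt
  withinTwo (Z i j) (X a b) = WithinTwo-sym (withinTwo-XZ a b i j)
  withinTwo (Z i j) (Y a b) = WithinTwo-sym (withinTwo-YZ a b i j)
  withinTwo (Z i j) (Z a b) = withinTwo-ZZ i j a b
  withinTwo (Z i j) H       = via (Y i j) (inj₁ (refl , refl)) tt
  withinTwo H       (X a b) = WithinTwo-sym (withinTwo (X a b) H)
  withinTwo H       (Y a b) = adjacent tt
  withinTwo H       (Z a b) = WithinTwo-sym (withinTwo (Z a b) H)
  withinTwo H       H       = inj₁ refl

  privateNeighbour-YY : ∀ i j a b → Y i j ≢ Y a b → ∃ λ w → Y i j ~ w × ¬ Y a b ~ w
  privateNeighbour-YY i j a b Yij≢Yab with i ≟ a | j ≟ b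
  ... | yes refl | yes refl = ⊥-elim (Yij≢Yab refl)
  ... | yes refl | no j≢b   = Z i j , inj₁ (refl , refl) , λ where
    (inj₁ (_ , b≡j)) → j≢b (sym b≡j)
    (inj₂ (i≢i , _)) → i≢i refl
  ... | no i≢a   | yes refl = Z i j , inj₁ (refl , refl) , λ where
    (inj₁ (a≡i , _)) → i≢a (sym a≡i)
    (inj₂ (_ , j≢j)) → j≢j refl
  ... | no i≢a   | no j≢b   = let c , c≢j , c≢b = ∃≢₂ j b in X i c , inj₁ (refl , c≢j) , λ where
    (inj₁ (i≡a , _)) → i≢a i≡a
    (inj₂ (_ , c≡b)) → c≢b c≡b

  privateNeighbour : ∀ {u v} → u ≢ v → ∃ λ w → u ~ w × ¬ v ~ w
  privateNeighbour {X i j} {X a b} u≢v = Z i j , (refl , refl) , λ { (refl , refl) → u≢v refl }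
  privateNeighbour {X i j} {Y a b} _   = let c , c≢j = ∃≢ j in Y i c , inj₁ (refl , ≢-sym c≢j) , λ ()
  privateNeighbour {X i j} {Z a b} _   = Z i j , (refl , refl) , λ ()
  privateNeighbour {X i j} {H}     _   = Z i j , (refl , refl) , λ ()
  privateNeighbour {Y i j} {X a b} _   = let c , c≢j = ∃≢ j in X i c , inj₁ (refl , c≢j) , λ ()
  privateNeighbour {Y i j} {Y a b} u≢v = privateNeighbour-YY i j a b u≢v
  privateNeighbour {Y i j} {Z a b} _   = Z i j , inj₁ (refl , refl) , λ ()
  privateNeighbour {Y i j} {H}     _   = let c , c≢j = ∃≢ j in X i c , inj₁ (refl , c≢j) , λ ()
  privateNeighbour {Z i j} {X a b} _   = X i j , (refl , refl) , λ ()
  privateNeighbour {Z i j} {Y a b} _   = Y i j , inj₁ (refl , refl) , λ ()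
  privateNeighbour {Z i j} {Z a b} u≢v = X i j , (refl , refl) , λ { (refl , refl) → u≢v refl }
  privateNeighbour {Z i j} {H}     _   = X i j , (refl , refl) , λ ()
  privateNeighbour {H}     {X a b} _   = Y a b , tt , λ where
    (inj₁ (_ , b≢b)) → b≢b refl
    (inj₂ (a≢a , _)) → a≢a refl
  privateNeighbour {H}     {Y a b} _   = Y a b , tt , λ ()
  privateNeighbour {H}     {Z a b} _   = let c , c≢b = ∃≢ b in Y a c , tt , λ where
    (inj₁ (_ , c≡b)) → c≢b c≡b
    (inj₂ (a≢a , _)) → a≢a refl
  privateNeighbour {H}     {H}     u≢v = ⊥-elim (u≢v refl)

  X-injective : X i j ≡ X a b → i ≡ a × j ≡ b
  X-injective refl = refl , refl

  Y-injective : Y i j ≡ Y a b → i ≡ a × j ≡ b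
  Y-injective refl = refl , refl

  δ : ℕ
  δ = suc R + R

  neighbours : Vertex → Vector Vertex δ
  neighbours (X i j) = Y i ∘ punchIn j ++ (Z i j ∷ λ a → Y (punchIn i a) j)
  neighbours (Y i j) = X i ∘ punchIn j ++ (H ∷ λ a → X (punchIn i a) j)
  neighbours (Z i j) = (λ c → Y (punchIn i zero) (punchIn j c)) ++
                       (X i j ∷ Y i j ∷ λ a → Y (punchIn i (suc a)) (punchIn j zero))
  neighbours H       = Y zero ∘ suc ++ (λ a → Y a zero)

  neighbours-adjacent : ∀ v k → v ~ neighbours v k
  neighbours-adjacent (X i j) = ∀-++ {P = X i j ~_}
    (λ c → inj₁ (refl , ≢-sym (punchInᵢ≢i j c)))
    (∀-∷ {P = X i j ~_} (refl , refl) λ a → inj₂ (≢-sym (punchInᵢ≢i i a) , refl))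
  neighbours-adjacent (Y i j) = ∀-++ {P = Y i j ~_}
    (λ c → inj₁ (refl , punchInᵢ≢i j c))
    (∀-∷ {P = Y i j ~_} tt λ a → inj₂ (punchInᵢ≢i i a , refl))
  neighbours-adjacent (Z i j) = ∀-++ {P = Z i j ~_}
    (λ c → inj₂ (punchInᵢ≢i i zero , punchInᵢ≢i j c))
    (∀-∷ {P = Z i j ~_} (refl , refl) (∀-∷ {P = Z i j ~_} (inj₁ (refl , refl))
      λ a → inj₂ (punchInᵢ≢i i (suc a) , punchInᵢ≢i j zero)))
  neighbours-adjacent H = ∀-++ {P = H ~_} {f = Y zero ∘ suc} (λ _ → tt) (λ _ → tt)

  neighbours-injective : ∀ v → Injective _≡_ _≡_ (neighbours v)
  neighbours-injective (X i j) = ++-injective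
    (punchIn-injective j _ _ ∘ proj₂ ∘ Y-injective)
    (∷-injective (punchIn-injective i _ _ ∘ proj₁ ∘ Y-injective) λ _ ())
    λ { _ zero () ; _ (suc a) eq → punchInᵢ≢i i a (sym (proj₁ (Y-injective eq))) }
  neighbours-injective (Y i j) = ++-injective
    (punchIn-injective j _ _ ∘ proj₂ ∘ X-injective)
    (∷-injective (punchIn-injective i _ _ ∘ proj₁ ∘ X-injective) λ _ ())
    λ { _ zero () ; _ (suc a) eq → punchInᵢ≢i i a (sym (proj₁ (X-injective eq))) }
  neighbours-injective (Z i j) = ++-injective
    (punchIn-injective j _ _ ∘ proj₂ ∘ Y-injective)
    (∷-injective (∷-injective (suc-injective ∘ punchIn-injective i _ _ ∘ proj₁ ∘ Y-injective)
                              λ a eq → punchInᵢ≢i i (suc a) (proj₁ (Y-injective eq)))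
                 λ { zero () ; (suc _) () })
    λ { _ zero () ; _ (suc zero) eq → punchInᵢ≢i i zero (proj₁ (Y-injective eq))
      ; _ (suc (suc a)) eq → case punchIn-injective i zero (suc a) (proj₁ (Y-injective eq)) of λ () }
  neighbours-injective H = ++-injective
    (suc-injective ∘ proj₂ ∘ Y-injective) (proj₁ ∘ Y-injective)
    λ _ _ eq → case proj₂ (Y-injective eq) of λ ()

  neighbours-X-complete : ∀ {i j w} → X i j ~ w → ∃ λ k → neighbours (X i j) k ≡ w
  neighbours-X-complete {i} {j} {Y a b} (inj₁ (refl , j≢b)) =
    punchOut j≢b ↑ˡ R , trans (lookup-++ˡ (Y i ∘ punchIn j) _ _) (cong (Y i) (punchIn-punchOut j≢b))
  neighbours-X-complete {i} {j} {Y a b} (inj₂ (i≢a , refl)) =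
    suc R ↑ʳ suc (punchOut i≢a) , trans (lookup-++ʳ (Y i ∘ punchIn j) _ _) (cong (λ r → Y r j) (punchIn-punchOut i≢a))
  neighbours-X-complete {i} {j} {Z a b} (refl , refl) = suc R ↑ʳ zero , lookup-++ʳ (Y i ∘ punchIn j) _ zero

  minDegree : HasMinDegree graph δ
  minDegree = δ≤degree , from (X zero zero) ,
    ≤-antisym (degree≤ {a = X zero zero} (neighbours (X zero zero)) neighbours-X-complete)
              (δ≤degree (from (X zero zero)))
    where
    δ≤degree : ∀ u → δ ≤ degree graph u
    δ≤degree u = ≤degree {u = u} (neighbours (to u)) (neighbours-injective (to u)) (neighbours-adjacent (to u))

  γ : ℕ
  γ = suc R

  isHub : Vertex → Bool
  isHub (Y _ zero)    = true
  isHub (Y _ (suc _)) = false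
  isHub H             = true
  isHub (X _ _)       = false
  isHub (Z _ _)       = false

  hubs : Vector Vertex γ
  hubs = H ∷ λ a → Y a zero

  hubs-enumerate : ∀ {v} → isHub v ≡ true → ∃ λ k → hubs k ≡ v
  hubs-enumerate {Y a zero} _ = suc a , refl
  hubs-enumerate {H}        _ = zero , refl

  hubs-isHub : ∀ k → isHub (hubs k) ≡ true
  hubs-isHub zero    = refl
  hubs-isHub (suc _) = refl

  hubs-dominate : ∀ v → isHub v ≡ true ⊎ ∃ λ w → isHub w ≡ true × v ~ w
  hubs-dominate (X i zero)    = inj₂ (Y (punchIn i zero) zero , refl , inj₂ (≢-sym (punchInᵢ≢i i zero) , refl))
  hubs-dominate (X i (suc j)) = inj₂ (Y i zero , refl , inj₁ (refl , λ ()))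
  hubs-dominate (Y _ _)       = inj₂ (H , refl , tt)
  hubs-dominate (Z i zero)    = inj₂ (Y i zero , refl , inj₁ (refl , refl))
  hubs-dominate (Z i (suc j)) = inj₂ (Y (punchIn i zero) zero , refl , inj₂ (punchInᵢ≢i i zero , λ ()))
  hubs-dominate H             = inj₂ (Y zero zero , refl , tt)

  data InRow (i : Fin R) (j : Fin C) : Vertex → Set where
    atX : InRow i j (X i j)
    atZ : InRow i j (Z i j)
    atY : ∀ b → InRow i j (Y i b)

  InRow-functional : ∀ {i i′ j v} → InRow i j v → InRow i′ j v → i ≡ i′
  InRow-functional atX     atX     = refl
  InRow-functional atZ     atZ     = refl
  InRow-functional (atY _) (atY _) = refl

  X-neighbour-InRow : ∀ {i j v} → X i j ~ v → InRow i j v ⊎ ∃ λ a → v ≡ Y a j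
  X-neighbour-InRow {v = Y _ b} (inj₁ (refl , _)) = inj₁ (atY b)
  X-neighbour-InRow {v = Y a _} (inj₂ (_ , refl)) = inj₂ (a , refl)
  X-neighbour-InRow {v = Z _ _} (refl , refl)     = inj₁ atZ

  column : Vertex → Fin C
  column (X _ j) = j
  column (Y _ j) = j
  column (Z _ j) = j
  column H       = zero  -- arbitrary: H lies in no column

  Y-neighbour-InRow-column : ∀ {a b i j w} → Y a b ~ w → InRow i j w → column w ≡ j
  Y-neighbour-InRow-column _ atX = refl
  Y-neighbour-InRow-column _ atZ = refl

  module _ {D : Subset m} (dom : Dominating graph D) where

    rowDominator : ∀ j → ¬ (∃ λ a → from (Y a j) ∈ D) → ∀ i → ∃ λ v → from v ∈ D × InRow i j v
    rowDominator j noYInColumn i with dominated dom (X i j)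
    ... | inj₁ Xij∈D = X i j , Xij∈D , atX
    ... | inj₂ (v , v∈D , Xij~v) with X-neighbour-InRow Xij~v
    ...   | inj₁ inRow        = v , v∈D , inRow
    ...   | inj₂ (a , refl)   = ⊥-elim (noYInColumn (a , v∈D))

    -- Each X(i,j) of a column j without Y's of D is dominated from inside row i, which gives R elements of D
    -- in distinct rows; w is not among them since it lies outside column j.
    γ≤∣D∣-freeColumn : ∀ {a b w} → from w ∈ D → Y a b ~ w → ∀ k →
                       ¬ (∃ λ a′ → from (Y a′ (punchIn (column w) k)) ∈ D) → γ ≤ ∣ D ∣
    γ≤∣D∣-freeColumn {w = w} w∈D Yab~w k noYInColumn =
      ≤∣D∣ (w ∷ proj₁ ∘ dominatorOf) (∷-injective rows-distinct w-new)
           (∀-∷ {P = λ v → from v ∈ D} w∈D (proj₁ ∘ proj₂ ∘ dominatorOf))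
      where
      dominatorOf : ∀ i → ∃ λ v → from v ∈ D × InRow i (punchIn (column w) k) v
      dominatorOf = rowDominator (punchIn (column w) k) noYInColumn
      rows-distinct : Injective _≡_ _≡_ (proj₁ ∘ dominatorOf)
      rows-distinct {i} {i′} eq = InRow-functional (proj₂ (proj₂ (dominatorOf i)))
        (subst (InRow i′ _) (sym eq) (proj₂ (proj₂ (dominatorOf i′))))
      w-new : ∀ i → proj₁ (dominatorOf i) ≢ w
      w-new i eq = punchInᵢ≢i (column w) k
        (sym (Y-neighbour-InRow-column Yab~w (subst (InRow i _) eq (proj₂ (proj₂ (dominatorOf i))))))

    γ≤∣D∣-from : ∀ {a b w} → from w ∈ D → Y a b ~ w → γ ≤ ∣ D ∣
    γ≤∣D∣-from {w = w} w∈D Yab~w with all? (λ k → any? (λ a → from (Y a (punchIn (column w) k)) ∈? D))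
    ... | yes everyColumnHit = ≤∣D∣ (λ k → Y (proj₁ (everyColumnHit k)) (punchIn (column w) k))
      (punchIn-injective (column w) _ _ ∘ proj₂ ∘ Y-injective) (proj₂ ∘ everyColumnHit)
    ... | no ¬everyColumnHit =
      let k , noYInColumn = ¬∀⟶∃¬ _ _ (λ k → any? (λ a → from (Y a (punchIn (column w) k)) ∈? D)) ¬everyColumnHit
      in γ≤∣D∣-freeColumn w∈D Yab~w k noYInColumn

    γ≤∣D∣ : γ ≤ ∣ D ∣
    γ≤∣D∣ with all? (λ a → all? (λ b → from (Y a b) ∈? D))
    ... | yes allY∈D = ≤∣D∣ (Y zero ∘ suc) (suc-injective ∘ proj₂ ∘ Y-injective) (λ k → allY∈D zero (suc k))
    ... | no ¬allY∈D with ¬∀⟶∃¬ R _ (λ a → all? (λ b → from (Y a b) ∈? D)) ¬allY∈D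
    ...   | a , ¬rowY∈D with ¬∀⟶∃¬ C _ (λ b → from (Y a b) ∈? D) ¬rowY∈D
    ...     | b , Yab∉D with dominated dom (Y a b)
    ...       | inj₁ Yab∈D             = ⊥-elim (Yab∉D Yab∈D)
    ...       | inj₂ (w , w∈D , Yab~w) = γ≤∣D∣-from w∈D Yab~w

  dominationNumber : HasDominationNumber graph γ
  dominationNumber = (vertexSet isHub , dominating hubs-dominate ,
                      ∣vertexSet∣≡ hubs hubs-injective hubs-isHub hubs-enumerate) , λ D → γ≤∣D∣
    where
    hubs-injective : Injective _≡_ _≡_ hubs
    hubs-injective = ∷-injective (proj₁ ∘ Y-injective) λ _ ()

  irreducible : Irreducible graph
  irreducible = triangleFree⇒¬K4 graph (triangleFree noTriangle) ,
                triangleFree⇒¬diamond graph (triangleFree noTriangle) ,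
                noNbhdSubset privateNeighbour

  diameter : HasDiameter graph 2
  diameter = hasDiameter2 withinTwo {X zero zero} {X zero (suc zero)} (λ ()) (λ ())

⌊√_⌋ : ∀ n → ∃ λ s → s * s ≤ n × n < suc s * suc s
⌊√ zero  ⌋ = zero , z≤n , s≤s z≤n
⌊√ suc n ⌋ with ⌊√ n ⌋
... | s , s²≤n , n<[1+s]² with suc n <? suc s * suc s
...   | yes 1+n<[1+s]² = s , m≤n⇒m≤1+n s²≤n , 1+n<[1+s]²
...   | no  1+n≮[1+s]² = suc s , ≮⇒≥ 1+n≮[1+s]² ,
  ≤-<-trans n<[1+s]² (*-mono-< (n<1+n (suc s)) (n<1+n (suc s)))

squeeze : ∀ {n t x} → n < suc (suc t) * suc (suc t) → suc t * suc t ≤ n →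
          suc (suc t) * suc (suc t) ≤ x → x ≤ 50 * (suc t * suc t) → n ≤ 1 * x × x ≤ 50 * n
squeeze {n} {t} {x} n<[2+t]² [1+t]²≤n [2+t]²≤x x≤50[1+t]² =
  subst (n ≤_) (sym (*-identityˡ x)) (≤-trans (<⇒≤ n<[2+t]²) [2+t]²≤x) ,
  ≤-trans x≤50[1+t]² (*-monoʳ-≤ 50 [1+t]²≤n)

⌊√_⌋⁺ : ∀ {n} → 1 ≤ n → ∃ λ t → suc t * suc t ≤ n × n < suc (suc t) * suc (suc t)
⌊√_⌋⁺ {n} 1≤n with ⌊√ n ⌋
... | zero  , _ , n<1              = contradiction 1≤n (<⇒≱ n<1)
... | suc t , [1+t]²≤n , n<[2+t]² = t , [1+t]²≤n , n<[2+t]²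

-- Stated with m, δ and γ unfolded: the ring solver treats defined constants as atoms.
m-slack : ∀ t → (3 + t) * (5 + t) + ((3 + t) * (5 + t) + ((3 + t) * (5 + t) + 1)) + (47 * (t * t) + 76 * t + 4)
                ≡ 50 * (suc t * suc t)
m-slack = solve-∀

δ²-slack : ∀ t → (4 + t + (3 + t)) * (4 + t + (3 + t)) + (46 * (t * t) + 72 * t + 1) ≡ 50 * (suc t * suc t)
δ²-slack = solve-∀

γ²-slack : ∀ t → (4 + t) * (4 + t) + (49 * (t * t) + 92 * t + 34) ≡ 50 * (suc t * suc t)
γ²-slack = solve-∀

module Bounds (t : ℕ) where

  open Construction t using (m; δ; γ)

  [2+t]²≤m : suc (suc t) * suc (suc t) ≤ m
  [2+t]²≤m = ≤-trans (*-mono-≤ (n≤1+n (2 + t)) (m≤n+m (2 + t) 3)) (m≤m+n _ _)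

  m≤50[1+t]² : m ≤ 50 * (suc t * suc t)
  m≤50[1+t]² = m+n≤o⇒m≤o _ (≤-reflexive (m-slack t))

  [2+t]²≤δ² : suc (suc t) * suc (suc t) ≤ δ * δ
  [2+t]²≤δ² = *-mono-≤ 2+t≤δ 2+t≤δ
    where
    2+t≤δ : 2 + t ≤ δ
    2+t≤δ = ≤-trans (m≤n+m (2 + t) 2) (m≤m+n (4 + t) (3 + t))

  δ²≤50[1+t]² : δ * δ ≤ 50 * (suc t * suc t)
  δ²≤50[1+t]² = m+n≤o⇒m≤o _ (≤-reflexive (δ²-slack t))

  [2+t]²≤γ² : suc (suc t) * suc (suc t) ≤ γ * γ
  [2+t]²≤γ² = *-mono-≤ (m≤n+m (2 + t) 2) (m≤n+m (2 + t) 2)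

  γ²≤50[1+t]² : γ * γ ≤ 50 * (suc t * suc t)
  γ²≤50[1+t]² = m+n≤o⇒m≤o _ (≤-reflexive (γ²-slack t))

theorem2 : Σ ℕ λ A → Σ ℕ λ B → (n : ℕ) → 1 ≤ n →
    Σ ℕ λ m → Σ (Graph m) λ G →
      Irreducible G × TriangleFree G × Colorable G 3 × HasDiameter G 2 ×
      (n ≤ A * m × m ≤ B * n) ×
      (Σ ℕ λ δ → HasMinDegree G δ × n ≤ A * (δ * δ) × δ * δ ≤ B * n) ×
      (Σ ℕ λ γ → HasDominationNumber G γ × n ≤ A * (γ * γ) × γ * γ ≤ B * n)
theorem2 = 1 , 50 , λ n 1≤n →
  let t , [1+t]²≤n , n<[2+t]² = ⌊√ 1≤n ⌋⁺
      open Construction t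
      open Bounds t
  in m , graph , irreducible , triangleFree noTriangle , colorable colour colour-proper , diameter ,
     squeeze n<[2+t]² [1+t]²≤n [2+t]²≤m m≤50[1+t]² ,
     (δ , minDegree , squeeze n<[2+t]² [1+t]²≤n [2+t]²≤δ² δ²≤50[1+t]²) ,
     (γ , dominationNumber , squeeze n<[2+t]² [1+t]²≤n [2+t]²≤γ² γ²≤50[1+t]²)
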